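{- For every $a, b \in \Lambda_{\mathrm{dB}}$ and $i \in \mathbb{N}_{>0}$, $\mathrm{sw}_i(a[b]) = \mathrm{sw}_{i+1}(a)\big[\mathrm{sw}_i(b)\big]$.
   Context: $\Lambda_{\mathrm{dB}}$ is the set of de Bruijn terms given by $a ::= n \mid a\,a \mid \lambda a$ with $n \in \mathbb{N}_{>0}$. Increment: for $i\in\mathbb{N}$, $\mathrm{inc}_i(n)=n$ if $n\le i$ and $n+1$ if $n>i$; $\mathrm{inc}_i(a\,b)=\mathrm{inc}_i(a)\,\mathrm{inc}_i(b)$; $\mathrm{inc}_i(\lambda a)=\lambda\,\mathrm{inc}_{i+1}(a)$. Swap: for $i\in\mathbb{N}_{>0}$, $\mathrm{sw}_i(n)=n$ if $n<i$ or $n>i+1$, $\mathrm{sw}_i(i)=i+1$, $\mathrm{sw}_i(i+1)=i$; $\mathrm{sw}_i(a\,b)=\mathrm{sw}_i(a)\,\mathrm{sw}_i(b)$; $\mathrm{sw}_i(\lambda a)=\lambda\,\mathrm{sw}_{i+1}(a)$. $\lambda r$ meta-substitution $a[c]$: $1[c]=c$, $n[c]=n-1$ for $n>1$; $(a\,b)[c]=a[c]\,b[c]$; $(\lambda a)[c]=\lambda\big(\mathrm{sw}_1(a)[\mathrm{inc}_0(c)]\big)$. -}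

module Defs where

open import Data.Nat using (ℕ; zero; suc; NonZero; _≤ᵇ_; _≡ᵇ_; _+_)
open import Data.Bool using (if_then_else_)

data Λ : Set where
  var : (n : ℕ) → {{NonZero n}} → Λ
  app : Λ → Λ → Λ
  lam : Λ → Λ

inc : ℕ → Λ → Λ
inc i (var n) = if n ≤ᵇ i then var n else var (suc n)
inc i (app a b) = app (inc i a) (inc i b)
inc i (lam a) = lam (inc (suc i) a)

sw : ℕ → Λ → Λ
sw i (var n) = swVar i n
  where
    swVar : ℕ → (n : ℕ) → {{NonZero n}} → Λ
    swVar zero n = var n   -- sw_0 is never used (i ∈ ℕ_{>0}); identity
    swVar (suc j) n =
      if n ≡ᵇ suc j then var (suc (suc j))
      else (if n ≡ᵇ suc (suc j) then var (suc j) else var n)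
sw i (app a b) = app (sw i a) (sw i b)
sw i (lam a) = lam (sw (suc i) a)

size : Λ → ℕ
size (var n) = 1
size (app a b) = suc (size a + size b)
size (lam a) = suc (size a)

-- The clause for λ recurses on sw_1(a), which is not a syntactic subterm,
-- so recursion is driven by a fuel argument.  Since size (sw i a) = size a,
-- fuel = size a never runs out, so the fallback clause (fuel 0) is unreachable.
substF : ℕ → Λ → Λ → Λ
substF zero a c = a
substF (suc f) (var (suc zero)) c = c
substF (suc f) (var (suc (suc k))) c = var (suc k)
substF (suc f) (app a b) c = app (substF f a c) (substF f b c)
substF (suc f) (lam a) c = lam (substF f (sw 1 a) (inc 0 c))

_[_] : Λ → Λ → Λ
a [ c ] = substF (size a) a c

-- Under
-- a binder the claim is needed at i + 1 for sw₁(a) and inc₀(b), and it closes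
-- because sw₁ commutes with sw_{i+3} (the swapped positions are disjoint) and
-- inc₀ commutes with sw_{i+1} (it shifts both swapped positions alike).  Since
-- sw preserves size, the fuel of sw_{i+2}(a)[…] is the same as that of a[b].

module Submission where

open import Defs
open import Data.Nat using (ℕ; zero; suc; _+_; _≤_; _<_; z≤n; s≤s; _≡ᵇ_; _≤ᵇ_)
open import Data.Bool using (if_then_else_)
open import Data.Nat.Properties using (≤-refl; ≤-reflexive; ≤-trans; m≤m+n; m≤n+m)
open import Data.Bool.Properties using (if-float)
open import Relation.Binary.PropositionalEquality
  using (_≡_; refl; cong; cong₂; sym; trans; module ≡-Reasoning)

-- On a variable, sw and inc act through the following maps on the 0-based index
-- m of  var (suc m) :  sw (suc j) exchanges j and suc j, and inc k shifts every
-- index ≥ k up by one.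

swapIndex : ℕ → ℕ → ℕ
swapIndex zero    zero          = 1
swapIndex zero    (suc zero)    = 0
swapIndex zero    (suc (suc m)) = suc (suc m)
swapIndex (suc j) zero          = zero
swapIndex (suc j) (suc m)       = suc (swapIndex j m)

liftIndex : ℕ → ℕ → ℕ
liftIndex zero    m       = suc m
liftIndex (suc k) zero    = zero
liftIndex (suc k) (suc m) = suc (liftIndex k m)

swapIndex-liftIndex : ∀ {k j} m → k ≤ j →
  swapIndex (suc j) (liftIndex k m) ≡ liftIndex k (swapIndex j m)
swapIndex-liftIndex {zero}          m       _         = refl
swapIndex-liftIndex {suc k} {suc j} zero    _         = refl
swapIndex-liftIndex {suc k} {suc j} (suc m) (s≤s k≤j) = cong suc (swapIndex-liftIndex m k≤j)

swapIndex-comm : ∀ {k j} m → suc k < j →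
  swapIndex k (swapIndex j m) ≡ swapIndex j (swapIndex k m)
swapIndex-comm {zero}  zero          (s≤s (s≤s _)) = refl
swapIndex-comm {zero}  (suc zero)    (s≤s (s≤s _)) = refl
swapIndex-comm {zero}  (suc (suc m)) (s≤s (s≤s _)) = refl
swapIndex-comm {suc k} zero          (s≤s _)       = refl
swapIndex-comm {suc k} (suc m)       (s≤s k+1<j)   = cong suc (swapIndex-comm m k+1<j)

-- inc 0 (var (suc m)) reduces to var (suc (suc m)), so inc 0 serves as the
-- successor on variables in the inductive step.
sw-var : ∀ j m → sw (suc j) (var (suc m)) ≡ var (suc (swapIndex j m))
sw-var zero    zero          = refl
sw-var zero    (suc zero)    = refl
sw-var zero    (suc (suc m)) = refl
sw-var (suc j) zero          = refl
sw-var (suc j) (suc m)       = begin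
  sw (suc (suc j)) (var (suc (suc m)))
    ≡⟨ cong (λ t → if m ≡ᵇ j then var (suc (suc (suc j))) else t)
         (sym (if-float (inc 0) (m ≡ᵇ suc j))) ⟩
  _ ≡⟨ sym (if-float (inc 0) (m ≡ᵇ j)) ⟩
  inc 0 (sw (suc j) (var (suc m)))
    ≡⟨ cong (inc 0) (sw-var j m) ⟩
  var (suc (suc (swapIndex j m)))
    ∎
  where open ≡-Reasoning

inc-var : ∀ k m → inc k (var (suc m)) ≡ var (suc (liftIndex k m))
inc-var zero    m       = refl
inc-var (suc k) zero    = refl
inc-var (suc k) (suc m) = begin
  inc (suc k) (var (suc (suc m)))    ≡⟨ sym (if-float (inc 0) (suc m ≤ᵇ k)) ⟩
  inc 0 (inc k (var (suc m)))        ≡⟨ cong (inc 0) (inc-var k m) ⟩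
  var (suc (suc (liftIndex k m)))    ∎
  where open ≡-Reasoning

size-sw : ∀ j a → size (sw j a) ≡ size a
size-sw zero    (var n)                = refl
size-sw (suc j) (var zero {{()}})
size-sw (suc j) (var (suc m))          = cong size (sw-var j m)
size-sw j       (app a b)              = cong₂ (λ x y → suc (x + y)) (size-sw j a) (size-sw j b)
size-sw j       (lam a)                = cong suc (size-sw (suc j) a)

sw-inc : ∀ {k j} a → k ≤ j → sw (suc (suc j)) (inc k a) ≡ inc k (sw (suc j) a)
sw-inc (var zero {{()}}) _
sw-inc {k} {j} (var (suc m)) k≤j = begin
  sw (suc (suc j)) (inc k (var (suc m)))        ≡⟨ cong (sw (suc (suc j))) (inc-var k m) ⟩
  sw (suc (suc j)) (var (suc (liftIndex k m)))  ≡⟨ sw-var (suc j) (liftIndex k m) ⟩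
  var (suc (swapIndex (suc j) (liftIndex k m))) ≡⟨ cong (λ x → var (suc x)) (swapIndex-liftIndex m k≤j) ⟩
  var (suc (liftIndex k (swapIndex j m)))       ≡⟨ sym (inc-var k (swapIndex j m)) ⟩
  inc k (var (suc (swapIndex j m)))             ≡⟨ cong (inc k) (sym (sw-var j m)) ⟩
  inc k (sw (suc j) (var (suc m)))              ∎
  where open ≡-Reasoning
sw-inc (app a b) k≤j = cong₂ app (sw-inc a k≤j) (sw-inc b k≤j)
sw-inc (lam a)   k≤j = cong lam (sw-inc a (s≤s k≤j))

sw-comm : ∀ {k j} a → suc k < j → sw (suc k) (sw (suc j) a) ≡ sw (suc j) (sw (suc k) a)
sw-comm (var zero {{()}}) _
sw-comm {k} {j} (var (suc m)) k+1<j = begin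
  sw (suc k) (sw (suc j) (var (suc m)))       ≡⟨ cong (sw (suc k)) (sw-var j m) ⟩
  sw (suc k) (var (suc (swapIndex j m)))      ≡⟨ sw-var k (swapIndex j m) ⟩
  var (suc (swapIndex k (swapIndex j m)))     ≡⟨ cong (λ x → var (suc x)) (swapIndex-comm m k+1<j) ⟩
  var (suc (swapIndex j (swapIndex k m)))     ≡⟨ sym (sw-var j (swapIndex k m)) ⟩
  sw (suc j) (var (suc (swapIndex k m)))      ≡⟨ cong (sw (suc j)) (sym (sw-var k m)) ⟩
  sw (suc j) (sw (suc k) (var (suc m)))       ∎
  where open ≡-Reasoning
sw-comm (app a b) k+1<j = cong₂ app (sw-comm a k+1<j) (sw-comm b k+1<j)
sw-comm (lam a)   k+1<j = cong lam (sw-comm a (s≤s k+1<j))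

sw-substF : ∀ {f} a b i → size a ≤ f →
  sw (suc i) (substF f a b) ≡ substF f (sw (suc (suc i)) a) (sw (suc i) b)
sw-substF {suc f} (var zero {{()}}) b i _
sw-substF {suc f} (var (suc zero)) b i _ =
  cong (λ t → substF (suc f) t (sw (suc i) b)) (sym (sw-var (suc i) zero))
sw-substF {suc f} (var (suc (suc m))) b i _ =
  trans (sw-var i m) (cong (λ t → substF (suc f) t (sw (suc i) b)) (sym (sw-var (suc i) (suc m))))
sw-substF {suc f} (app a c) b i (s≤s size≤f) = cong₂ app
  (sw-substF a b i (≤-trans (m≤m+n (size a) (size c)) size≤f))
  (sw-substF c b i (≤-trans (m≤n+m (size c) (size a)) size≤f))
sw-substF {suc f} (lam a) b i (s≤s size≤f) = cong lam (begin
  sw (suc (suc i)) (substF f (sw 1 a) (inc 0 b))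
    ≡⟨ sw-substF (sw 1 a) (inc 0 b) (suc i) (≤-trans (≤-reflexive (size-sw 1 a)) size≤f) ⟩
  substF f (sw (suc (suc (suc i))) (sw 1 a)) (sw (suc (suc i)) (inc 0 b))
    ≡⟨ cong₂ (substF f) (sym (sw-comm a (s≤s (s≤s z≤n)))) (sw-inc b z≤n) ⟩
  substF f (sw 1 (sw (suc (suc (suc i))) a)) (inc 0 (sw (suc i) b))
    ∎)
  where open ≡-Reasoning

lemma17 : (a b : Λ) (i : ℕ) → sw (suc i) (a [ b ]) ≡ (sw (suc (suc i)) a [ sw (suc i) b ])
lemma17 a b i = begin
  sw (suc i) (substF (size a) a b)
    ≡⟨ sw-substF a b i ≤-refl ⟩
  substF (size a) (sw (suc (suc i)) a) (sw (suc i) b)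
    ≡⟨ cong (λ f → substF f (sw (suc (suc i)) a) (sw (suc i) b)) (sym (size-sw (suc (suc i)) a)) ⟩
  substF (size (sw (suc (suc i)) a)) (sw (suc (suc i)) a) (sw (suc i) b)
    ∎
  where open ≡-Reasoning
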